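{- For every positive integer $s$, $d_4(21s+5,3)=16s+3$.
   Context: $\mathbb{F}_4=\{0,1,\omega,\omega^2\}$ with $\omega^2=\omega+1$, $\overline{x}=x^2$. A quaternary $[n,k]$ code is a $k$-dimensional subspace of $\mathbb{F}_4^n$; its minimum weight is its minimum nonzero Hamming weight. The Hermitian dual is $C^{\perp_H}=\{x : \sum_i x_i\overline{y_i}=0\ \forall y\in C\}$, and $C$ is Hermitian LCD if $C\cap C^{\perp_H}=\{0\}$. $d_4(n,k)$ is the largest minimum weight among all quaternary Hermitian LCD $[n,k]$ codes. -}

module Defs where

open import Data.Nat using (ℕ; zero; suc; _≤_)
open import Data.Vec using (Vec; []; _∷_; replicate; zipWith; map; foldr)
open import Data.Product using (Σ; ∃; _×_; _,_)
open import Relation.Binary.PropositionalEquality using (_≡_; _≢_)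

data F4 : Set where
   𝟎 𝟏 ω ω² : F4

infixl 6 _+F_
infixl 7 _*F_

_+F_ : F4 → F4 → F4
𝟎  +F y  = y
x  +F 𝟎  = x
𝟏  +F 𝟏  = 𝟎
𝟏  +F ω  = ω²
𝟏  +F ω² = ω
ω  +F 𝟏  = ω²
ω  +F ω  = 𝟎
ω  +F ω² = 𝟏
ω² +F 𝟏  = ω
ω² +F ω  = 𝟏
ω² +F ω² = 𝟎

_*F_ : F4 → F4 → F4
𝟎  *F y  = 𝟎
𝟏  *F y  = y
ω  *F 𝟎  = 𝟎
ω  *F 𝟏  = ω
ω  *F ω  = ω²
ω  *F ω² = 𝟏
ω² *F 𝟎  = 𝟎
ω² *F 𝟏  = ω²
ω² *F ω  = 𝟏
ω² *F ω² = ω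

-- conjugation x ↦ x̄ = x²
conj : F4 → F4
conj 𝟎  = 𝟎
conj 𝟏  = 𝟏
conj ω  = ω²
conj ω² = ω

zeroV : (n : ℕ) → Vec F4 n
zeroV n = replicate n 𝟎

_+V_ : {n : ℕ} → Vec F4 n → Vec F4 n → Vec F4 n
_+V_ = zipWith _+F_

scaleV : {n : ℕ} → F4 → Vec F4 n → Vec F4 n
scaleV a = map (a *F_)

lincomb : {n k : ℕ} → Vec F4 k → Vec (Vec F4 n) k → Vec F4 n
lincomb {n} [] [] = zeroV n
lincomb (c ∷ cs) (g ∷ gs) = scaleV c g +V lincomb cs gs

herm : {n : ℕ} → Vec F4 n → Vec F4 n → F4
herm [] [] = 𝟎
herm (x ∷ xs) (y ∷ ys) = (x *F conj y) +F herm xs ys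

wt : {n : ℕ} → Vec F4 n → ℕ
wt [] = 0
wt (𝟎 ∷ xs) = wt xs
wt (_ ∷ xs) = suc (wt xs)

-- A quaternary [n,k] code is presented by a generator matrix: k linearly
-- independent rows in F4^n; the code is their span (dimension exactly k).
LinIndep : {n k : ℕ} → Vec (Vec F4 n) k → Set
LinIndep {n} {k} G = (c : Vec F4 k) → lincomb c G ≡ zeroV n → c ≡ zeroV k

_∈C_ : {n k : ℕ} → Vec F4 n → Vec (Vec F4 n) k → Set
_∈C_ {n} {k} x G = Σ (Vec F4 k) (λ c → lincomb c G ≡ x)

_∈HDual_ : {n k : ℕ} → Vec F4 n → Vec (Vec F4 n) k → Set
_∈HDual_ {n} x G = (y : Vec F4 n) → y ∈C G → herm x y ≡ 𝟎

HermLCD : {n k : ℕ} → Vec (Vec F4 n) k → Set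
HermLCD {n} G = (x : Vec F4 n) → x ∈C G → x ∈HDual G → x ≡ zeroV n

MinWeight : {n k : ℕ} → Vec (Vec F4 n) k → ℕ → Set
MinWeight {n} G d =
  Σ (Vec F4 n) (λ x → x ∈C G × x ≢ zeroV n × wt x ≡ d)
  × ((x : Vec F4 n) → x ∈C G → x ≢ zeroV n → d ≤ wt x)

D4 : ℕ → ℕ → ℕ → Set
D4 n k d =
  Σ (Vec (Vec F4 n) k) (λ G → LinIndep G × HermLCD G × MinWeight G d)
  × ((G : Vec (Vec F4 n) k) (d' : ℕ) →
       LinIndep G → HermLCD G → MinWeight G d' → d' ≤ d)

-- Upper bound: for a code with three independent rows, every nonzero column is nonzero in
-- exactly 48 of the 63 nonzero codewords, so summing weights gives 63 d ≤ 48 n, which for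
-- n = 21s + 5 means d ≤ 16s + 3.
-- Lower bound: juxtapose a [26,3,19] code whose Hermitian Gram matrix is nonsingular with
-- s − 1 copies of the simplex code of PG(2,4). The simplex code is Hermitian self-orthogonal
-- and all its nonzero codewords have weight 16, so the copies leave the Hermitian form of the
-- base code unchanged (the result is still LCD) and add exactly 16(s − 1) to every nonzero
-- weight. The facts about the two small codes are decided by evaluation over all of F4³.
module Submission where

open import Defs
open import Data.Nat using (ℕ; _+_; _*_; _≤_; zero; suc; z≤n; z<s; _<_; _≤?_; _≟_)
open import Data.Nat.Properties
open import Data.Nat.Tactic.RingSolver using (solve-∀)
open import Data.Bool using (if_then_else_)
open import Data.Product using (_×_; _,_)
open import Data.Vec using (Vec; []; _∷_; replicate; zipWith; map; _++_; concat; head; tail; transpose)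
open import Data.Vec.Properties using (map-++; zipWith-is-⊛; ≡-dec)
open import Function using (_∘_)
open import Relation.Binary.Definitions using (DecidableEquality)
open import Relation.Binary.PropositionalEquality
open import Relation.Nullary using (Dec; yes; no; does)
open import Relation.Nullary.Decidable using (map′; _×-dec_; _→-dec_; ¬?; from-yes)
open import Relation.Unary using (Decidable)

private
  variable
    k m n l : ℕ

infix 4 _≟F_ _≟ᵛ_

_≟F_ : DecidableEquality F4
𝟎  ≟F 𝟎  = yes refl
𝟎  ≟F 𝟏  = no λ ()
𝟎  ≟F ω  = no λ ()
𝟎  ≟F ω² = no λ ()
𝟏  ≟F 𝟎  = no λ ()
𝟏  ≟F 𝟏  = yes refl
𝟏  ≟F ω  = no λ ()
𝟏  ≟F ω² = no λ ()
ω  ≟F 𝟎  = no λ ()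
ω  ≟F 𝟏  = no λ ()
ω  ≟F ω  = yes refl
ω  ≟F ω² = no λ ()
ω² ≟F 𝟎  = no λ ()
ω² ≟F 𝟏  = no λ ()
ω² ≟F ω  = no λ ()
ω² ≟F ω² = yes refl

_≟ᵛ_ : DecidableEquality (Vec F4 k)
_≟ᵛ_ = ≡-dec _≟F_

∀-F4? : {P : F4 → Set} → Decidable P → Dec (∀ x → P x)
∀-F4? {P} P? = map′ fromCases toCases (P? 𝟎 ×-dec P? 𝟏 ×-dec P? ω ×-dec P? ω²)
  where
  fromCases : P 𝟎 × P 𝟏 × P ω × P ω² → ∀ x → P x
  fromCases (p , _ , _ , _) 𝟎  = p
  fromCases (_ , p , _ , _) 𝟏  = p
  fromCases (_ , _ , p , _) ω  = p
  fromCases (_ , _ , _ , p) ω² = p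
  toCases : (∀ x → P x) → P 𝟎 × P 𝟏 × P ω × P ω²
  toCases f = f 𝟎 , f 𝟏 , f ω , f ω²

∀-Vec? : ∀ k {P : Vec F4 k → Set} → Decidable P → Dec (∀ v → P v)
∀-Vec? zero    P? = map′ (λ { p [] → p }) (λ f → f []) (P? [])
∀-Vec? (suc k) P? = map′ (λ { f (x ∷ v) → f x v }) (λ f x v → f (x ∷ v))
                      (∀-F4? λ x → ∀-Vec? k λ v → P? (x ∷ v))

+F-identityʳ : ∀ x → x +F 𝟎 ≡ x
+F-identityʳ 𝟎  = refl
+F-identityʳ 𝟏  = refl
+F-identityʳ ω  = refl
+F-identityʳ ω² = refl

+F-assoc : ∀ x y z → (x +F y) +F z ≡ x +F (y +F z)
+F-assoc = from-yes (∀-F4? λ x → ∀-F4? λ y → ∀-F4? λ z → (x +F y) +F z ≟F x +F (y +F z))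

ind : F4 → ℕ
ind 𝟎 = 0
ind _ = 1

wt-∷ : ∀ x (xs : Vec F4 n) → wt (x ∷ xs) ≡ ind x + wt xs
wt-∷ 𝟎  xs = refl
wt-∷ 𝟏  xs = refl
wt-∷ ω  xs = refl
wt-∷ ω² xs = refl

wt-++ : (xs : Vec F4 m) (ys : Vec F4 n) → wt (xs ++ ys) ≡ wt xs + wt ys
wt-++ []       ys = refl
wt-++ (x ∷ xs) ys = begin
  wt (x ∷ xs ++ ys)         ≡⟨ wt-∷ x (xs ++ ys) ⟩
  ind x + wt (xs ++ ys)     ≡⟨ cong (ind x +_) (wt-++ xs ys) ⟩
  ind x + (wt xs + wt ys)   ≡⟨ +-assoc (ind x) (wt xs) (wt ys) ⟨
  ind x + wt xs + wt ys     ≡⟨ cong (_+ wt ys) (wt-∷ x xs) ⟨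
  wt (x ∷ xs) + wt ys       ∎
  where open ≡-Reasoning

wt-zeroV : ∀ n → wt (zeroV n) ≡ 0
wt-zeroV zero    = refl
wt-zeroV (suc n) = wt-zeroV n

herm-zeroˡ : (y : Vec F4 n) → herm (zeroV n) y ≡ 𝟎
herm-zeroˡ []       = refl
herm-zeroˡ (y ∷ ys) = herm-zeroˡ ys

herm-++ : (xs ys : Vec F4 m) (xs′ ys′ : Vec F4 n) →
          herm (xs ++ xs′) (ys ++ ys′) ≡ herm xs ys +F herm xs′ ys′
herm-++ []       []       xs′ ys′ = refl
herm-++ (x ∷ xs) (y ∷ ys) xs′ ys′ = begin
  x *F conj y +F herm (xs ++ xs′) (ys ++ ys′)      ≡⟨ cong (x *F conj y +F_) (herm-++ xs ys xs′ ys′) ⟩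
  x *F conj y +F (herm xs ys +F herm xs′ ys′)      ≡⟨ +F-assoc (x *F conj y) _ _ ⟨
  x *F conj y +F herm xs ys +F herm xs′ ys′        ∎
  where open ≡-Reasoning

dot : Vec F4 k → Vec F4 k → F4
dot []       []       = 𝟎
dot (c ∷ cs) (x ∷ xs) = c *F x +F dot cs xs

codeword : Vec F4 k → Vec (Vec F4 k) n → Vec F4 n
codeword c = map (dot c)

codeword-zero : (cols : Vec (Vec F4 k) n) → codeword (zeroV k) cols ≡ zeroV n
codeword-zero []         = refl
codeword-zero (v ∷ cols) = cong₂ _∷_ (dot-zeroˡ v) (codeword-zero cols)
  where
  dot-zeroˡ : (v : Vec F4 k) → dot (zeroV k) v ≡ 𝟎
  dot-zeroˡ []      = refl
  dot-zeroˡ (_ ∷ v) = dot-zeroˡ v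

lincomb-zipWith-∷ : (c v : Vec F4 k) (G : Vec (Vec F4 n) k) →
                    lincomb c (zipWith _∷_ v G) ≡ dot c v ∷ lincomb c G
lincomb-zipWith-∷ []       []      []      = refl
lincomb-zipWith-∷ (c ∷ cs) (x ∷ v) (g ∷ G) =
  cong (scaleV c (x ∷ g) +V_) (lincomb-zipWith-∷ cs v G)

lincomb-transpose : (c : Vec F4 k) (cols : Vec (Vec F4 k) n) →
                    lincomb c (transpose cols) ≡ codeword c cols
lincomb-transpose c []         = lincomb-empty c
  where
  lincomb-empty : (c : Vec F4 k) → lincomb c (replicate k []) ≡ []
  lincomb-empty []      = refl
  lincomb-empty (_ ∷ c) = cong (zipWith _+F_ []) (lincomb-empty c)
lincomb-transpose c (v ∷ cols) = begin
  lincomb c (transpose (v ∷ cols))            ≡⟨ cong (lincomb c) (zipWith-is-⊛ _∷_ v (transpose cols)) ⟨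
  lincomb c (zipWith _∷_ v (transpose cols))  ≡⟨ lincomb-zipWith-∷ c v (transpose cols) ⟩
  dot c v ∷ lincomb c (transpose cols)        ≡⟨ cong (dot c v ∷_) (lincomb-transpose c cols) ⟩
  codeword c (v ∷ cols)                       ∎
  where open ≡-Reasoning

-- The Hermitian Gram matrix G Ḡᵀ is nonsingular, i.e. G has full rank and spans an LCD code.
HermNondegenerate : Vec (Vec F4 k) n → Set
HermNondegenerate {k} cols =
  ∀ c → (∀ e → herm (codeword c cols) (codeword e cols) ≡ 𝟎) → c ≡ zeroV k

SelfOrthogonal : Vec (Vec F4 k) n → Set
SelfOrthogonal cols = ∀ c e → herm (codeword c cols) (codeword e cols) ≡ 𝟎

ConstantWeight : ℕ → Vec (Vec F4 k) n → Set
ConstantWeight {k} w cols = ∀ c → c ≢ zeroV k → wt (codeword c cols) ≡ w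

WeightAtLeast : ℕ → Vec (Vec F4 k) n → Set
WeightAtLeast {k} d cols = ∀ c → c ≢ zeroV k → d ≤ wt (codeword c cols)

module _ (cols : Vec (Vec F4 k) n) where

  herm-lincomb-transpose : ∀ c e → herm (lincomb c (transpose cols)) (lincomb e (transpose cols))
                                 ≡ herm (codeword c cols) (codeword e cols)
  herm-lincomb-transpose c e = cong₂ herm (lincomb-transpose c cols) (lincomb-transpose e cols)

  nondegenerate⇒linIndep : HermNondegenerate cols → LinIndep (transpose cols)
  nondegenerate⇒linIndep nondeg c cG≡0 = nondeg c λ e → begin
    herm (codeword c cols) (codeword e cols)  ≡⟨ cong (λ x → herm x (codeword e cols)) c·cols≡0 ⟩
    herm (zeroV n) (codeword e cols)          ≡⟨ herm-zeroˡ (codeword e cols) ⟩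
    𝟎                                         ∎
    where
    open ≡-Reasoning
    c·cols≡0 : codeword c cols ≡ zeroV n
    c·cols≡0 = trans (sym (lincomb-transpose c cols)) cG≡0

  nondegenerate⇒hermLCD : HermNondegenerate cols → HermLCD (transpose cols)
  nondegenerate⇒hermLCD nondeg x (c , refl) x∈dual = begin
    lincomb c (transpose cols)  ≡⟨ lincomb-transpose c cols ⟩
    codeword c cols             ≡⟨ cong (λ c → codeword c cols) c≡0 ⟩
    codeword (zeroV k) cols     ≡⟨ codeword-zero cols ⟩
    zeroV n                     ∎
    where
    open ≡-Reasoning
    c≡0 : c ≡ zeroV k
    c≡0 = nondeg c λ e → trans (sym (herm-lincomb-transpose c e)) (x∈dual _ (e , refl))

  minWeight-transpose : ∀ {d} → LinIndep (transpose cols) →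
                        (c₀ : Vec F4 k) → c₀ ≢ zeroV k → wt (codeword c₀ cols) ≡ d →
                        WeightAtLeast d cols → MinWeight (transpose cols) d
  minWeight-transpose {d} linIndep c₀ c₀≢0 wt≡d atLeast =
    (lincomb c₀ (transpose cols) , (c₀ , refl) , c₀≢0 ∘ linIndep c₀ ,
     trans (cong wt (lincomb-transpose c₀ cols)) wt≡d) ,
    λ { x (c , refl) x≢0 → subst (d ≤_) (cong wt (sym (lincomb-transpose c cols)))
          (atLeast c λ { refl → x≢0 (trans (lincomb-transpose (zeroV k) cols) (codeword-zero cols)) }) }

module _ (c e : Vec F4 k) (xs : Vec (Vec F4 k) m) (ys : Vec (Vec F4 k) n) where

  wt-codeword-++ : wt (codeword c (xs ++ ys)) ≡ wt (codeword c xs) + wt (codeword c ys)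
  wt-codeword-++ = trans (cong wt (map-++ (dot c) xs ys)) (wt-++ (codeword c xs) (codeword c ys))

  herm-codeword-++ : herm (codeword c (xs ++ ys)) (codeword e (xs ++ ys))
                   ≡ herm (codeword c xs) (codeword e xs) +F herm (codeword c ys) (codeword e ys)
  herm-codeword-++ = trans (cong₂ herm (map-++ (dot c) xs ys) (map-++ (dot e) xs ys))
                           (herm-++ (codeword c xs) (codeword e xs) (codeword c ys) (codeword e ys))

module Juxtaposition (B : Vec (Vec F4 k) m) (S : Vec (Vec F4 k) l) (s : ℕ) where

  copies : ∀ r → Vec (Vec F4 k) (r * l)
  copies r = concat (replicate r S)

  juxtaposed : Vec (Vec F4 k) (m + s * l)
  juxtaposed = B ++ copies s

  wt-codeword-copies : ∀ r c → wt (codeword c (copies r)) ≡ r * wt (codeword c S)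
  wt-codeword-copies zero    c = refl
  wt-codeword-copies (suc r) c =
    trans (wt-codeword-++ c c S (copies r)) (cong (wt (codeword c S) +_) (wt-codeword-copies r c))

  herm-codeword-copies : SelfOrthogonal S → ∀ r c e → herm (codeword c (copies r)) (codeword e (copies r)) ≡ 𝟎
  herm-codeword-copies orth zero    c e = refl
  herm-codeword-copies orth (suc r) c e =
    trans (herm-codeword-++ c e S (copies r)) (cong₂ _+F_ (orth c e) (herm-codeword-copies orth r c e))

  herm-codeword-juxtaposed : SelfOrthogonal S → ∀ c e →
    herm (codeword c juxtaposed) (codeword e juxtaposed) ≡ herm (codeword c B) (codeword e B)
  herm-codeword-juxtaposed orth c e = begin
    herm (codeword c juxtaposed) (codeword e juxtaposed)    ≡⟨ herm-codeword-++ c e B (copies s) ⟩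
    herm (codeword c B) (codeword e B) +F
      herm (codeword c (copies s)) (codeword e (copies s))  ≡⟨ cong (herm (codeword c B) (codeword e B) +F_) (herm-codeword-copies orth s c e) ⟩
    herm (codeword c B) (codeword e B) +F 𝟎                 ≡⟨ +F-identityʳ _ ⟩
    herm (codeword c B) (codeword e B)                      ∎
    where open ≡-Reasoning

  juxtaposed-nondegenerate : HermNondegenerate B → SelfOrthogonal S → HermNondegenerate juxtaposed
  juxtaposed-nondegenerate nondegB orth c c⊥ =
    nondegB c λ e → trans (sym (herm-codeword-juxtaposed orth c e)) (c⊥ e)

  wt-codeword-juxtaposed : ∀ {w} → ConstantWeight w S → ∀ c → c ≢ zeroV k →
                           wt (codeword c juxtaposed) ≡ wt (codeword c B) + s * w
  wt-codeword-juxtaposed constant c c≢0 =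
    trans (wt-codeword-++ c c B (copies s))
          (cong (wt (codeword c B) +_) (trans (wt-codeword-copies s c) (cong (s *_) (constant c c≢0))))

  juxtaposed-weightAtLeast : ∀ {d w} → WeightAtLeast d B → ConstantWeight w S → WeightAtLeast (d + s * w) juxtaposed
  juxtaposed-weightAtLeast atLeast constant c c≢0 =
    subst (_ ≤_) (sym (wt-codeword-juxtaposed constant c c≢0)) (+-monoˡ-≤ _ (atLeast c c≢0))

∑F4 : (F4 → ℕ) → ℕ
∑F4 f = f 𝟎 + f 𝟏 + f ω + f ω²

∑F4-cong : {f g : F4 → ℕ} → (∀ x → f x ≡ g x) → ∑F4 f ≡ ∑F4 g
∑F4-cong f≗g = cong₂ _+_ (cong₂ _+_ (cong₂ _+_ (f≗g 𝟎) (f≗g 𝟏)) (f≗g ω)) (f≗g ω²)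

∑F4-mono-≤ : {f g : F4 → ℕ} → (∀ x → f x ≤ g x) → ∑F4 f ≤ ∑F4 g
∑F4-mono-≤ f≤g = +-mono-≤ (+-mono-≤ (+-mono-≤ (f≤g 𝟎) (f≤g 𝟏)) (f≤g ω)) (f≤g ω²)

∑F4-+ : (f g : F4 → ℕ) → ∑F4 (λ x → f x + g x) ≡ ∑F4 f + ∑F4 g
∑F4-+ f g = interchange (f 𝟎) (f 𝟏) (f ω) (f ω²) (g 𝟎) (g 𝟏) (g ω) (g ω²)
  where
  interchange : ∀ a b c d a′ b′ c′ d′ →
    (a + a′) + (b + b′) + (c + c′) + (d + d′) ≡ (a + b + c + d) + (a′ + b′ + c′ + d′)
  interchange = solve-∀

∑F4-*ʳ : (f : F4 → ℕ) (d : ℕ) → ∑F4 (λ x → f x * d) ≡ ∑F4 f * d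
∑F4-*ʳ f d = distrib (f 𝟎) (f 𝟏) (f ω) (f ω²) d
  where
  distrib : ∀ a b c e d → a * d + b * d + c * d + e * d ≡ (a + b + c + e) * d
  distrib = solve-∀

∑Vec : ∀ k → (Vec F4 k → ℕ) → ℕ
∑Vec zero    f = f []
∑Vec (suc k) f = ∑F4 λ x → ∑Vec k λ v → f (x ∷ v)

∑Vec-mono-≤ : ∀ k {f g : Vec F4 k → ℕ} → (∀ v → f v ≤ g v) → ∑Vec k f ≤ ∑Vec k g
∑Vec-mono-≤ zero    f≤g = f≤g []
∑Vec-mono-≤ (suc k) f≤g = ∑F4-mono-≤ λ x → ∑Vec-mono-≤ k λ v → f≤g (x ∷ v)

∑Vec-+ : ∀ k (f g : Vec F4 k → ℕ) → ∑Vec k (λ v → f v + g v) ≡ ∑Vec k f + ∑Vec k g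
∑Vec-+ zero    f g = refl
∑Vec-+ (suc k) f g =
  trans (∑F4-cong λ x → ∑Vec-+ k (f ∘ (x ∷_)) (g ∘ (x ∷_)))
        (∑F4-+ (λ x → ∑Vec k (f ∘ (x ∷_))) (λ x → ∑Vec k (g ∘ (x ∷_))))

∑Vec-*ʳ : ∀ k (f : Vec F4 k → ℕ) d → ∑Vec k (λ v → f v * d) ≡ ∑Vec k f * d
∑Vec-*ʳ zero    f d = refl
∑Vec-*ʳ (suc k) f d =
  trans (∑F4-cong λ x → ∑Vec-*ʳ k (f ∘ (x ∷_)) d) (∑F4-*ʳ (λ x → ∑Vec k (f ∘ (x ∷_))) d)

zipWith-∷-head-tail : {A : Set} (G : Vec (Vec A (suc n)) k) → zipWith _∷_ (map head G) (map tail G) ≡ G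
zipWith-∷-head-tail []             = refl
zipWith-∷-head-tail ((x ∷ g) ∷ G) = cong ((x ∷ g) ∷_) (zipWith-∷-head-tail G)

wt-lincomb-∷ : (c : Vec F4 k) (G : Vec (Vec F4 (suc n)) k) →
               wt (lincomb c G) ≡ ind (dot c (map head G)) + wt (lincomb c (map tail G))
wt-lincomb-∷ c G = begin
  wt (lincomb c G)                                          ≡⟨ cong (wt ∘ lincomb c) (zipWith-∷-head-tail G) ⟨
  wt (lincomb c (zipWith _∷_ (map head G) (map tail G)))    ≡⟨ cong wt (lincomb-zipWith-∷ c (map head G) (map tail G)) ⟩
  wt (dot c (map head G) ∷ lincomb c (map tail G))          ≡⟨ wt-∷ (dot c (map head G)) (lincomb c (map tail G)) ⟩
  ind (dot c (map head G)) + wt (lincomb c (map tail G))    ∎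
  where open ≡-Reasoning

column-support≤48 : ∀ v → ∑Vec 3 (λ c → ind (dot c v)) ≤ 48
column-support≤48 = from-yes (∀-Vec? 3 λ v → ∑Vec 3 (λ c → ind (dot c v)) ≤? 48)

∑-wt-lincomb≤ : ∀ n (G : Vec (Vec F4 n) 3) → ∑Vec 3 (λ c → wt (lincomb c G)) ≤ 48 * n
∑-wt-lincomb≤ zero    G = ∑Vec-mono-≤ 3 λ c → ≤-reflexive (wt-empty (lincomb c G))
  where
  wt-empty : (x : Vec F4 0) → wt x ≡ 0
  wt-empty [] = refl
∑-wt-lincomb≤ (suc n) G = begin
  ∑Vec 3 (λ c → wt (lincomb c G))                       ≤⟨ ∑Vec-mono-≤ 3 (λ c → ≤-reflexive (wt-lincomb-∷ c G)) ⟩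
  ∑Vec 3 (λ c → ind (dot c v) + wt (lincomb c G′))      ≡⟨ ∑Vec-+ 3 (λ c → ind (dot c v)) (λ c → wt (lincomb c G′)) ⟩
  ∑Vec 3 (λ c → ind (dot c v)) + ∑Vec 3 (λ c → wt (lincomb c G′))
                                                        ≤⟨ +-mono-≤ (column-support≤48 v) (∑-wt-lincomb≤ n G′) ⟩
  48 + 48 * n                                           ≡⟨ *-suc 48 n ⟨
  48 * suc n                                            ∎
  where
  open ≤-Reasoning
  v = map head G
  G′ = map tail G

nonzeroIndicator : Vec F4 k → ℕ
nonzeroIndicator {k} c = if does (c ≟ᵛ zeroV k) then 0 else 1

nonzeroIndicator*minWeight≤wt : {G : Vec (Vec F4 n) k} {d : ℕ} → LinIndep G → MinWeight G d →
                         ∀ c → nonzeroIndicator c * d ≤ wt (lincomb c G)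
nonzeroIndicator*minWeight≤wt {k = k} {G = G} {d} linIndep (_ , atLeast) c with c ≟ᵛ zeroV k
... | yes _   = z≤n
... | no c≢0 = subst (_≤ wt (lincomb c G)) (sym (*-identityˡ d))
                 (atLeast (lincomb c G) (c , refl) (c≢0 ∘ linIndep c))

plotkin-bound : {G : Vec (Vec F4 n) 3} {d : ℕ} → LinIndep G → MinWeight G d → 63 * d ≤ 48 * n
plotkin-bound {n} {G} {d} linIndep minWeight = begin
  63 * d                                   ≡⟨ ∑Vec-*ʳ 3 nonzeroIndicator d ⟨
  ∑Vec 3 (λ c → nonzeroIndicator c * d)           ≤⟨ ∑Vec-mono-≤ 3 (nonzeroIndicator*minWeight≤wt linIndep minWeight) ⟩
  ∑Vec 3 (λ c → wt (lincomb c G))          ≤⟨ ∑-wt-lincomb≤ n G ⟩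
  48 * n                                   ∎
  where open ≤-Reasoning

plotkin-arithmetic : ∀ s d → 63 * d ≤ 48 * (26 + s * 21) → d ≤ 19 + s * 16
plotkin-arithmetic s d 63d≤48n = ≮⇒≥ λ 19+16s<d → <⇒≱ gap (≤-trans (*-monoʳ-≤ 63 19+16s<d) 63d≤48n)
  where
  gap : 48 * (26 + s * 21) < 63 * suc (19 + s * 16)
  gap = subst (48 * (26 + s * 21) <_) (sym (excess s)) (m<m+n _ z<s)
    where
    excess : ∀ s → 63 * suc (19 + s * 16) ≡ 48 * (26 + s * 21) + 12
    excess = solve-∀

-- The 20 points of PG(2,4) other than ⟨1,ω,ω⟩.
otherPoints : Vec (Vec F4 3) 20
otherPoints =
  (𝟎 ∷ 𝟎 ∷ 𝟏 ∷ []) ∷ (𝟎 ∷ 𝟏 ∷ 𝟎 ∷ []) ∷ (𝟎 ∷ 𝟏 ∷ 𝟏 ∷ []) ∷ (𝟎 ∷ 𝟏 ∷ ω ∷ []) ∷ (𝟎 ∷ 𝟏 ∷ ω² ∷ []) ∷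
  (𝟏 ∷ 𝟎 ∷ 𝟎 ∷ []) ∷ (𝟏 ∷ 𝟎 ∷ 𝟏 ∷ []) ∷ (𝟏 ∷ 𝟎 ∷ ω ∷ []) ∷ (𝟏 ∷ 𝟎 ∷ ω² ∷ []) ∷
  (𝟏 ∷ 𝟏 ∷ 𝟎 ∷ []) ∷ (𝟏 ∷ 𝟏 ∷ 𝟏 ∷ []) ∷ (𝟏 ∷ 𝟏 ∷ ω ∷ []) ∷ (𝟏 ∷ 𝟏 ∷ ω² ∷ []) ∷
  (𝟏 ∷ ω ∷ 𝟎 ∷ []) ∷ (𝟏 ∷ ω ∷ 𝟏 ∷ []) ∷ (𝟏 ∷ ω ∷ ω² ∷ []) ∷
  (𝟏 ∷ ω² ∷ 𝟎 ∷ []) ∷ (𝟏 ∷ ω² ∷ 𝟏 ∷ []) ∷ (𝟏 ∷ ω² ∷ ω ∷ []) ∷ (𝟏 ∷ ω² ∷ ω² ∷ []) ∷ []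

simplexColumns : Vec (Vec F4 3) 21
simplexColumns = (𝟏 ∷ ω ∷ ω ∷ []) ∷ otherPoints

baseColumns : Vec (Vec F4 3) 26
baseColumns =
  (𝟎 ∷ 𝟏 ∷ 𝟎 ∷ []) ∷ otherPoints ++
  (𝟎 ∷ 𝟏 ∷ ω ∷ []) ∷ (𝟏 ∷ 𝟏 ∷ ω ∷ []) ∷ (𝟏 ∷ 𝟏 ∷ ω² ∷ []) ∷ (𝟏 ∷ ω² ∷ 𝟎 ∷ []) ∷ (𝟏 ∷ ω² ∷ ω ∷ []) ∷ []

simplex-selfOrthogonal : SelfOrthogonal simplexColumns
simplex-selfOrthogonal = from-yes (∀-Vec? 3 λ c → ∀-Vec? 3 λ e →
  herm (codeword c simplexColumns) (codeword e simplexColumns) ≟F 𝟎)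

simplex-constantWeight : ConstantWeight 16 simplexColumns
simplex-constantWeight = from-yes (∀-Vec? 3 λ c →
  ¬? (c ≟ᵛ zeroV 3) →-dec wt (codeword c simplexColumns) ≟ 16)

base-nondegenerate : HermNondegenerate baseColumns
base-nondegenerate = from-yes (∀-Vec? 3 λ c →
  (∀-Vec? 3 λ e → herm (codeword c baseColumns) (codeword e baseColumns) ≟F 𝟎) →-dec c ≟ᵛ zeroV 3)

base-weightAtLeast : WeightAtLeast 19 baseColumns
base-weightAtLeast = from-yes (∀-Vec? 3 λ c →
  ¬? (c ≟ᵛ zeroV 3) →-dec 19 ≤? wt (codeword c baseColumns))

d4-juxtaposed : ∀ s → D4 (26 + s * 21) 3 (19 + s * 16)
d4-juxtaposed s =
  (transpose juxtaposed , linIndep , nondegenerate⇒hermLCD juxtaposed nondegenerate ,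
   minWeight-transpose juxtaposed linIndep e₃ (λ ()) (wt-codeword-juxtaposed simplex-constantWeight e₃ (λ ()))
     (juxtaposed-weightAtLeast base-weightAtLeast simplex-constantWeight)) ,
  λ _ d linIndep′ _ minWeight → plotkin-arithmetic s d (plotkin-bound linIndep′ minWeight)
  where
  open Juxtaposition baseColumns simplexColumns s
  nondegenerate : HermNondegenerate juxtaposed
  nondegenerate = juxtaposed-nondegenerate base-nondegenerate simplex-selfOrthogonal
  linIndep : LinIndep (transpose juxtaposed)
  linIndep = nondegenerate⇒linIndep juxtaposed nondegenerate
  e₃ : Vec F4 3
  e₃ = 𝟎 ∷ 𝟎 ∷ 𝟏 ∷ []

proposition5p4 : (s : ℕ) → 1 ≤ s → D4 (21 * s + 5) 3 (16 * s + 3)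
proposition5p4 (suc s) _ = subst₂ (λ n d → D4 n 3 d) (length≡ s) (distance≡ s) (d4-juxtaposed s)
  where
  length≡ : ∀ s → 26 + s * 21 ≡ 21 * suc s + 5
  length≡ = solve-∀
  distance≡ : ∀ s → 19 + s * 16 ≡ 16 * suc s + 3
  distance≡ = solve-∀
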